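{- Let $k>2$ be a prime such that $2^k-1$ is prime. Let $n = 2^{\alpha-1}(2^k-1)^{\beta-1}$, where $\alpha,\beta>1$ are integers. Then $n$ does not divide $\sigma_k(n)$.
   Context: For a positive integer $n$ and integer $k\ge 1$, $\sigma_k(n)=\sum_{d\mid n} d^k$, the sum over positive divisors $d$ of $n$. -}

module Defs where

open import Data.Nat using (ℕ; zero; suc; _^_)
open import Data.Nat.Divisibility using (_∣?_)
open import Data.List using (List; filter; map; upTo)
open import Data.Nat.ListAction using (sum)

divisors : ℕ → List ℕ
divisors n = filter (_∣? n) (map suc (upTo n))

σ : ℕ → ℕ → ℕ
σ k n = sum (map (λ d → d ^ k) (divisors n))

module Submission where

-- Since 2 and p are distinct primes, the divisors of n are the 2ⁱpʲ
-- (i ≤ a, j ≤ b), so σₖ(n) = S·T with S = Σ_{i≤a} (2ᵏ)ⁱ and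
-- T = Σ_{j≤b} (pᵏ)ʲ.  S is odd and T ≡ 1 (mod p), so n ∣ S·T forces
-- pᵇ ∣ S and 2ᵃ ∣ T.
--   * p-part.  S = Σ_{i≤a} (1+p)ⁱ ≡ a+1 (mod p), hence p ≤ a+1, i.e.
--     2ᵏ ≤ a+2; and p·pᵇ ≤ p·S < (1+p)^(a+1).
--   * 2-part.  pᵏ is odd, so 2 ∣ T forces b+1 = 2c, and then
--     T = (1+pᵏ)·Σ_{i<c} (p²ᵏ)ⁱ where 1+pᵏ = 2ᵏ·(odd) because k is odd;
--     a 2-adic lemma for geometric sums of ratio ≡ 1 (mod 4) gives
--     2^(a−k) ∣ c.
--   * Since 1+p ≤ p², the bound p^(2c) < (1+p)^(a+1) gives c ≤ a, so
--     2^(a−k) ≤ a; with 2ᵏ ≤ a+2 and k ≥ 3 this is impossible.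

open import Defs
open import Data.Nat.Base
open import Data.Nat.Properties
open import Data.Nat.Divisibility
open import Data.Nat.Primality
open import Data.Nat.Coprimality using (Coprime; coprime-divisor)
open import Data.Nat.ListAction using (sum)
open import Data.Nat.ListAction.Properties using (sum-++; sum-↭)
open import Data.Nat.Tactic.RingSolver using (solve-∀)
open import Data.Product using (Σ; _×_; _,_; proj₁; proj₂)
open import Data.Sum using (_⊎_; inj₁; inj₂)
open import Data.Empty using (⊥)
open import Data.List using (List; []; _∷_; map; upTo; applyUpTo; cartesianProductWith; _++_)
open import Data.List.Properties using (map-++; map-upTo)
open import Data.List.Membership.Propositional using (_∈_)
open import Data.List.Membership.Propositional.Properties
  using (∈-filter⁺; ∈-filter⁻; ∈-map⁺; ∈-upTo⁺; ∈-upTo⁻; ∈-cartesianProductWith⁺; ∈-cartesianProductWith⁻)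
open import Data.List.Membership.Propositional.Properties.WithK using (unique∧set⇒bag)
open import Data.List.Relation.Unary.Unique.Propositional using (Unique)
import Data.List.Relation.Unary.Unique.Propositional.Properties as Unique
open import Data.List.Relation.Binary.Permutation.Propositional using (_↭_)
import Data.List.Relation.Binary.Permutation.Propositional.Properties as Perm
open import Data.List.Relation.Binary.BagAndSetEquality using (∼bag⇒↭)
open import Function.Bundles using (mk⇔)
open import Relation.Binary.Definitions using (tri<; tri≈; tri>)
open import Relation.Binary.PropositionalEquality
open import Relation.Nullary using (¬_; yes; no; contradiction)
open ≡-Reasoning

prime∤⇒coprime : ∀ {q d} → Prime q → ¬ q ∣ d → Coprime d q
prime∤⇒coprime pq q∤d {e} (e∣d , e∣q) with prime⇒irreducible pq e∣q
... | inj₁ e≡1 = e≡1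
... | inj₂ refl = contradiction e∣d q∤d

prime-power-split : ∀ {q} → Prime q → ∀ e m d → d ∣ q ^ e * m →
  Σ ℕ λ i → Σ ℕ λ d' → i ≤ e × d ≡ q ^ i * d' × d' ∣ m
prime-power-split pq zero m d d∣m =
  0 , d , z≤n , sym (+-identityʳ d) , subst (d ∣_) (+-identityʳ m) d∣m
prime-power-split {q} pq (suc e) m d d∣qqᵉm with q ∣? d
... | yes (divides d₁ refl) with prime-power-split pq e m d₁ d₁∣qᵉm
  where
  d₁∣qᵉm : d₁ ∣ q ^ e * m
  d₁∣qᵉm = *-cancelˡ-∣ q {{prime⇒nonZero pq}}
    (subst₂ _∣_ (*-comm d₁ q) (*-assoc q (q ^ e) m) d∣qqᵉm)
...   | i , d' , i≤e , refl , d'∣m =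
  suc i , d' , s≤s i≤e , trans (*-comm (q ^ i * d') q) (sym (*-assoc q (q ^ i) d')) , d'∣m
prime-power-split {q} pq (suc e) m d d∣qqᵉm | no q∤d
  with prime-power-split pq e m d
         (coprime-divisor (prime∤⇒coprime pq q∤d) (subst (d ∣_) (*-assoc q (q ^ e) m) d∣qqᵉm))
... | i , d' , i≤e , d≡ , d'∣m = i , d' , m≤n⇒m≤1+n i≤e , d≡ , d'∣m

prime-power-cancel : ∀ {q s x} → Prime q → ¬ q ∣ s → ∀ e → q ^ e ∣ s * x → q ^ e ∣ x
prime-power-cancel {q} {s} pq q∤s e = coprime-divisor qᵉ-coprime-s
  where
  qᵉ-coprime-s : Coprime (q ^ e) s
  qᵉ-coprime-s {d} (d∣qᵉ , d∣s)
    with prime-power-split pq e 1 d (subst (d ∣_) (sym (*-identityʳ (q ^ e))) d∣qᵉ)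
  ... | zero , d' , _ , refl , d'∣1 = trans (*-identityˡ d') (∣1⇒≡1 d'∣1)
  ... | suc i , d' , _ , refl , _ = contradiction (∣-trans (∣m⇒∣m*n d' (m∣m*n (q ^ i))) d∣s) q∤s

^-monoʳ-∣ : ∀ r {i e} → i ≤ e → r ^ i ∣ r ^ e
^-monoʳ-∣ r {i} {e} i≤e = divides (r ^ (e ∸ i))
  (trans (cong (r ^_) (sym (m∸n+n≡m i≤e))) (^-distribˡ-+-* r (e ∸ i) i))

separate-prime-powers : ∀ {q p S T} → Prime q → Prime p → ¬ q ∣ S → ¬ p ∣ T →
  ∀ A B → q ^ A * p ^ B ∣ S * T → q ^ A ∣ T × p ^ B ∣ S
separate-prime-powers {q} {p} {S} {T} pq pp q∤S p∤T A B n∣ST =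
  prime-power-cancel pq q∤S A (∣-trans (m∣m*n (p ^ B)) n∣ST) ,
  prime-power-cancel pp p∤T B (∣-trans (n∣m*n (q ^ A)) (subst (q ^ A * p ^ B ∣_) (*-comm S T) n∣ST))

^-∣-cancel : ∀ q .{{_ : NonZero q}} a k y → q ^ a ∣ q ^ k * y → q ^ (a ∸ k) ∣ y
^-∣-cancel q a k y qᵃ∣qᵏy with k ≤? a
... | yes k≤a = *-cancelˡ-∣ (q ^ k) {{m^n≢0 q k}} (subst (_∣ q ^ k * y) qᵃ≡ qᵃ∣qᵏy)
  where
  qᵃ≡ : q ^ a ≡ q ^ k * q ^ (a ∸ k)
  qᵃ≡ = trans (cong (q ^_) (sym (m+[n∸m]≡n k≤a))) (^-distribˡ-+-* q k (a ∸ k))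
... | no k≰a rewrite m≤n⇒m∸n≡0 (≰⇒≥ k≰a) = 1∣ y

prime∣^⇒∣ : ∀ {q p} → Prime q → ∀ j → q ∣ p ^ j → q ∣ p
prime∣^⇒∣ pq zero q∣1 = contradiction (∣1⇒≡1 q∣1) (nonTrivial⇒≢1 {{prime⇒nonTrivial pq}})
prime∣^⇒∣ {p = p} pq (suc j) q∣ppʲ with euclidsLemma p (p ^ j) pq q∣ppʲ
... | inj₁ q∣p = q∣p
... | inj₂ q∣pʲ = prime∣^⇒∣ pq j q∣pʲ

prime∤1+multiple : ∀ {p} → Prime p → ∀ x → ¬ p ∣ 1 + p * x
prime∤1+multiple {p} pp x p∣1+px = nonTrivial⇒≢1 {{prime⇒nonTrivial pp}}
  (∣1⇒≡1 (∣m+n∣m⇒∣n (subst (p ∣_) (+-comm 1 (p * x)) p∣1+px) (m∣m*n x)))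

divisor-of-two-prime-powers : ∀ {q p} → Prime q → Prime p → ∀ a b d → d ∣ q ^ a * p ^ b →
  Σ ℕ λ i → Σ ℕ λ j → i ≤ a × j ≤ b × d ≡ q ^ i * p ^ j
divisor-of-two-prime-powers {q} {p} pq pp a b d d∣n with prime-power-split pq a (p ^ b) d d∣n
... | i , d' , i≤a , refl , d'∣pᵇ
  with prime-power-split pp b 1 d' (subst (d' ∣_) (sym (*-identityʳ (p ^ b))) d'∣pᵇ)
... | j , d'' , j≤b , refl , d''∣1 rewrite ∣1⇒≡1 d''∣1 =
  i , j , i≤a , j≤b , cong (q ^ i *_) (*-identityʳ (p ^ j))

^-injectiveʳ : ∀ p → 1 < p → ∀ {i j} → p ^ i ≡ p ^ j → i ≡ j
^-injectiveʳ p 1<p {i} {j} pⁱ≡pʲ with <-cmp i j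
... | tri< i<j _ _ = contradiction pⁱ≡pʲ (<⇒≢ (^-monoʳ-< p 1<p i<j))
... | tri≈ _ i≡j _ = i≡j
... | tri> _ _ j<i = contradiction (sym pⁱ≡pʲ) (<⇒≢ (^-monoʳ-< p 1<p j<i))

two-prime-powers-injective : ∀ {q p} → Prime q → Prime p → ¬ q ∣ p →
  ∀ {i i' j j'} → q ^ i * p ^ j ≡ q ^ i' * p ^ j' → i ≡ i' × j ≡ j'
two-prime-powers-injective {q} {p} pq pp q∤p = injective
  where
  q∣qⁱ⁺¹pʲ : ∀ i j → q ∣ q ^ suc i * p ^ j
  q∣qⁱ⁺¹pʲ i j = ∣m⇒∣m*n (p ^ j) (m∣m*n (q ^ i))

  q∤pʲ : ∀ j → ¬ q ∣ 1 * p ^ j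
  q∤pʲ j q∣pʲ = q∤p (prime∣^⇒∣ pq j (subst (q ∣_) (*-identityˡ (p ^ j)) q∣pʲ))

  injective : ∀ {i i' j j'} → q ^ i * p ^ j ≡ q ^ i' * p ^ j' → i ≡ i' × j ≡ j'
  injective {zero} {zero} eq = refl ,
    ^-injectiveʳ p (nonTrivial⇒n>1 p {{prime⇒nonTrivial pp}})
      (trans (sym (*-identityˡ _)) (trans eq (*-identityˡ _)))
  injective {zero} {suc i'} {j} {j'} eq = contradiction (subst (q ∣_) (sym eq) (q∣qⁱ⁺¹pʲ i' j')) (q∤pʲ j)
  injective {suc i} {zero} {j} {j'} eq = contradiction (subst (q ∣_) eq (q∣qⁱ⁺¹pʲ i j)) (q∤pʲ j')
  injective {suc i} {suc i'} {j} {j'} eq with injective {i} {i'} {j} {j'}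
    (*-cancelˡ-≡ _ _ q {{prime⇒nonZero pq}} (trans (sym (*-assoc q (q ^ i) _)) (trans eq (*-assoc q (q ^ i') _))))
  ... | i≡i' , j≡j' = cong suc i≡i' , j≡j'

module TwoPrimePowers {q p} (q-prime : Prime q) (p-prime : Prime p) (q∤p : ¬ q ∣ p) (a b : ℕ) where

  term : ℕ → ℕ → ℕ
  term i j = q ^ i * p ^ j

  terms : List ℕ
  terms = cartesianProductWith term (upTo (suc a)) (upTo (suc b))

  instance
    q≢0 : NonZero q
    q≢0 = prime⇒nonZero q-prime
    p≢0 : NonZero p
    p≢0 = prime⇒nonZero p-prime

  term≢0 : ∀ i j → NonZero (term i j)
  term≢0 i j = m*n≢0 (q ^ i) (p ^ j) {{m^n≢0 q i}} {{m^n≢0 p j}}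

  private
    n = term a b
    instance
      n≢0 : NonZero n
      n≢0 = term≢0 a b

  divisors-unique : Unique (divisors n)
  divisors-unique = Unique.filter⁺ (_∣? n) (Unique.map⁺ suc-injective (Unique.upTo⁺ n))

  terms-unique : Unique terms
  terms-unique = Unique.cartesianProductWith⁺ term (two-prime-powers-injective q-prime p-prime q∤p)
    (Unique.upTo⁺ (suc a)) (Unique.upTo⁺ (suc b))

  divisor⇒term : ∀ {d} → d ∈ divisors n → d ∈ terms
  divisor⇒term {d} d∈ with ∈-filter⁻ (_∣? n) {xs = map suc (upTo n)} d∈
  ... | _ , d∣n with divisor-of-two-prime-powers q-prime p-prime a b d d∣n
  ... | i , j , i≤a , j≤b , refl = ∈-cartesianProductWith⁺ term (∈-upTo⁺ (s≤s i≤a)) (∈-upTo⁺ (s≤s j≤b))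

  term⇒divisor : ∀ {d} → d ∈ terms → d ∈ divisors n
  term⇒divisor d∈ with ∈-cartesianProductWith⁻ term (upTo (suc a)) (upTo (suc b)) d∈
  ... | i , j , i∈ , j∈ , refl = ∈-filter⁺ (_∣? n) (in-range (term i j) {{term≢0 i j}} term∣n) term∣n
    where
    term∣n : term i j ∣ n
    term∣n = *-pres-∣ (^-monoʳ-∣ q (s≤s⁻¹ (∈-upTo⁻ i∈))) (^-monoʳ-∣ p (s≤s⁻¹ (∈-upTo⁻ j∈)))
    in-range : ∀ d → .{{NonZero d}} → d ∣ n → d ∈ map suc (upTo n)
    in-range (suc d) d∣n = ∈-map⁺ suc (∈-upTo⁺ (∣⇒≤ d∣n))

  divisors↭terms : divisors n ↭ terms
  divisors↭terms = ∼bag⇒↭ (unique∧set⇒bag divisors-unique terms-unique (mk⇔ divisor⇒term term⇒divisor))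

-- geom x m = 1 + x + ⋯ + x^(m−1).
geom : ℕ → ℕ → ℕ
geom x zero = 0
geom x (suc m) = 1 + x * geom x m

sum-applyUpTo-geom : ∀ x c m (f : ℕ → ℕ) → (∀ i → f i ≡ c * x ^ i) →
  sum (applyUpTo f m) ≡ c * geom x m
sum-applyUpTo-geom x c zero f f≡ = sym (*-zeroʳ c)
sum-applyUpTo-geom x c (suc m) f f≡ = begin
  f 0 + sum (applyUpTo (λ i → f (suc i)) m)
    ≡⟨ cong₂ _+_ (trans (f≡ 0) (*-identityʳ c))
         (sum-applyUpTo-geom x (c * x) m (λ i → f (suc i))
           (λ i → trans (f≡ (suc i)) (sym (*-assoc c x (x ^ i))))) ⟩
  c + c * x * geom x m ≡⟨ distrib c x (geom x m) ⟩
  c * (1 + x * geom x m) ∎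
  where
  distrib : ∀ c x g → c + c * x * g ≡ c * (1 + x * g)
  distrib = solve-∀

geom-as-sum : ∀ x m → sum (map (x ^_) (upTo m)) ≡ geom x m
geom-as-sum x m = begin
  sum (map (x ^_) (upTo m))  ≡⟨ cong sum (map-upTo (x ^_) m) ⟩
  sum (applyUpTo (x ^_) m)   ≡⟨ sum-applyUpTo-geom x 1 m (x ^_) (λ i → sym (*-identityˡ (x ^ i))) ⟩
  1 * geom x m               ≡⟨ *-identityˡ (geom x m) ⟩
  geom x m                   ∎

sum-*ˡ : ∀ c (ys : List ℕ) → sum (map (c *_) ys) ≡ c * sum ys
sum-*ˡ c [] = sym (*-zeroʳ c)
sum-*ˡ c (y ∷ ys) = trans (cong (c * y +_) (sum-*ˡ c ys)) (sym (*-distribˡ-+ c y (sum ys)))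

sum-cartesianProductWith : ∀ (F : ℕ → ℕ → ℕ) (h u v : ℕ → ℕ) → (∀ x y → h (F x y) ≡ u x * v y) →
  ∀ xs ys → sum (map h (cartesianProductWith F xs ys)) ≡ sum (map u xs) * sum (map v ys)
sum-cartesianProductWith F h u v h≡ [] ys = refl
sum-cartesianProductWith F h u v h≡ (x ∷ xs) ys = begin
  sum (map h (map (F x) ys ++ rest))
    ≡⟨ cong sum (map-++ h (map (F x) ys) rest) ⟩
  sum (map h (map (F x) ys) ++ map h rest)
    ≡⟨ sum-++ (map h (map (F x) ys)) (map h rest) ⟩
  sum (map h (map (F x) ys)) + sum (map h rest)
    ≡⟨ cong₂ _+_ (trans (cong sum (row ys)) (sum-*ˡ (u x) (map v ys)))
                 (sum-cartesianProductWith F h u v h≡ xs ys) ⟩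
  u x * sum (map v ys) + sum (map u xs) * sum (map v ys)
    ≡⟨ sym (*-distribʳ-+ (sum (map v ys)) (u x) (sum (map u xs))) ⟩
  (u x + sum (map u xs)) * sum (map v ys) ∎
  where
  rest = cartesianProductWith F xs ys
  row : ∀ zs → map h (map (F x) zs) ≡ map (u x *_) (map v zs)
  row [] = refl
  row (z ∷ zs) = cong₂ _∷_ (h≡ x z) (row zs)

^-distribʳ-* : ∀ m n k → (m * n) ^ k ≡ m ^ k * n ^ k
^-distribʳ-* m n zero = refl
^-distribʳ-* m n (suc k) = begin
  m * n * (m * n) ^ k     ≡⟨ cong (m * n *_) (^-distribʳ-* m n k) ⟩
  m * n * (m ^ k * n ^ k) ≡⟨ [m*n]*[o*p]≡[m*o]*[n*p] m n (m ^ k) (n ^ k) ⟩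
  m * m ^ k * (n * n ^ k) ∎

^-swap : ∀ q i k → (q ^ i) ^ k ≡ (q ^ k) ^ i
^-swap q i k = begin
  (q ^ i) ^ k ≡⟨ ^-*-assoc q i k ⟩
  q ^ (i * k) ≡⟨ cong (q ^_) (*-comm i k) ⟩
  q ^ (k * i) ≡⟨ ^-*-assoc q k i ⟨
  (q ^ k) ^ i ∎

σ-two-prime-powers : ∀ {q p} → Prime q → Prime p → ¬ q ∣ p → ∀ k a b →
  σ k (q ^ a * p ^ b) ≡ geom (q ^ k) (suc a) * geom (p ^ k) (suc b)
σ-two-prime-powers {q} {p} pq pp q∤p k a b = begin
  σ k (q ^ a * p ^ b)
    ≡⟨ sum-↭ (Perm.map⁺ (_^ k) divisors↭terms) ⟩
  sum (map (_^ k) terms)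
    ≡⟨ sum-cartesianProductWith term (_^ k) ((q ^ k) ^_) ((p ^ k) ^_) termᵏ (upTo (suc a)) (upTo (suc b)) ⟩
  sum (map ((q ^ k) ^_) (upTo (suc a))) * sum (map ((p ^ k) ^_) (upTo (suc b)))
    ≡⟨ cong₂ _*_ (geom-as-sum (q ^ k) (suc a)) (geom-as-sum (p ^ k) (suc b)) ⟩
  geom (q ^ k) (suc a) * geom (p ^ k) (suc b) ∎
  where
  open TwoPrimePowers pq pp q∤p a b
  termᵏ : ∀ i j → term i j ^ k ≡ (q ^ k) ^ i * (p ^ k) ^ j
  termᵏ i j = trans (^-distribʳ-* (q ^ i) (p ^ j) k) (cong₂ _*_ (^-swap q i k) (^-swap p j k))

2∤odd : ∀ t → ¬ 2 ∣ 1 + 2 * t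
2∤odd = prime∤1+multiple prime[2]

geom-mod : ∀ r m → Σ ℕ λ h → geom (1 + r) m ≡ m + r * h
geom-mod r zero = 0 , sym (*-zeroʳ r)
geom-mod r (suc m) with geom-mod r m
... | h , geom≡ = h + m + r * h , (begin
  1 + (1 + r) * geom (1 + r) m ≡⟨ cong (λ g → 1 + (1 + r) * g) geom≡ ⟩
  1 + (1 + r) * (m + r * h)    ≡⟨ expand r m h ⟩
  suc m + r * (h + m + r * h)  ∎)
  where
  expand : ∀ r m h → 1 + (1 + r) * (m + r * h) ≡ suc m + r * (h + m + r * h)
  expand = solve-∀

geom-telescope : ∀ p m → p * geom (1 + p) m + 1 ≡ (1 + p) ^ m
geom-telescope p zero = cong (_+ 1) (*-zeroʳ p)
geom-telescope p (suc m) = begin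
  p * (1 + (1 + p) * geom (1 + p) m) + 1 ≡⟨ regroup p (geom (1 + p) m) ⟩
  (1 + p) * (p * geom (1 + p) m + 1)     ≡⟨ cong ((1 + p) *_) (geom-telescope p m) ⟩
  (1 + p) * (1 + p) ^ m                  ∎
  where
  regroup : ∀ p g → p * (1 + (1 + p) * g) + 1 ≡ (1 + p) * (p * g + 1)
  regroup = solve-∀

geom-double : ∀ y c → geom y (c + c) ≡ (1 + y) * geom (y * y) c
geom-double y zero = sym (*-zeroʳ (1 + y))
geom-double y (suc c) = begin
  geom y (suc c + suc c)                     ≡⟨ cong (λ m → geom y (suc m)) (+-suc c c) ⟩
  1 + y * (1 + y * geom y (c + c))           ≡⟨ cong (λ g → 1 + y * (1 + y * g)) (geom-double y c) ⟩
  1 + y * (1 + y * ((1 + y) * geom (y * y) c)) ≡⟨ regroup y (geom (y * y) c) ⟩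
  (1 + y) * (1 + y * y * geom (y * y) c)     ∎
  where
  regroup : ∀ y g → 1 + y * (1 + y * ((1 + y) * g)) ≡ (1 + y) * (1 + y * y * g)
  regroup = solve-∀

geom-prime∤ : ∀ {p} → Prime p → ∀ y m → ¬ p ∣ geom (p * y) (suc m)
geom-prime∤ {p} pp y m p∣geom =
  prime∤1+multiple pp (y * geom (p * y) m) (subst (p ∣_) (cong suc (*-assoc p y _)) p∣geom)

geom-even⇒even-length : ∀ r m → 2 ∣ geom (1 + 2 * r) m → Σ ℕ λ c → m ≡ c + c
geom-even⇒even-length r m 2∣geom with geom-mod (2 * r) m
... | h , geom≡ with ∣m+n∣m⇒∣n (subst (2 ∣_) (trans geom≡ (+-comm m (2 * r * h))) 2∣geom)
                              (∣m⇒∣m*n h (m∣m*n r))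
... | divides c refl = c , double c
  where
  double : ∀ c → c * 2 ≡ c + c
  double = solve-∀

geom-2-adic : ∀ e t m → 2 ^ e ∣ geom (1 + 4 * t) m → 2 ^ e ∣ m
geom-2-adic zero t m _ = 1∣ m
geom-2-adic (suc e) t m 2ᵉ⁺¹∣geom
  with geom-even⇒even-length (2 * t) m
         (∣-trans (m∣m*n (2 ^ e)) (subst (λ y → 2 ^ suc e ∣ geom y m) (ratio≡ t) 2ᵉ⁺¹∣geom))
  where
  ratio≡ : ∀ t → 1 + 4 * t ≡ 1 + 2 * (2 * t)
  ratio≡ = solve-∀
... | c , refl = subst (2 ^ suc e ∣_) (double c) (*-monoʳ-∣ 2 2ᵉ∣c)
  where
  y = 1 + 4 * t
  factor : ∀ t g → (1 + (1 + 4 * t)) * g ≡ 2 * ((1 + 2 * t) * g)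
  factor = solve-∀
  square : ∀ t → (1 + 4 * t) * (1 + 4 * t) ≡ 1 + 4 * (2 * t + 4 * (t * t))
  square = solve-∀
  double : ∀ c → 2 * c ≡ c + c
  double = solve-∀
  2ᵉ∣odd*geom : 2 ^ e ∣ (1 + 2 * t) * geom (y * y) c
  2ᵉ∣odd*geom = *-cancelˡ-∣ 2
    (subst (2 ^ suc e ∣_) (trans (geom-double y c) (factor t (geom (y * y) c))) 2ᵉ⁺¹∣geom)
  2ᵉ∣c : 2 ^ e ∣ c
  2ᵉ∣c = geom-2-adic e (2 * t + 4 * (t * t)) c
    (subst (λ z → 2 ^ e ∣ geom z c) (square t) (prime-power-cancel prime[2] (2∤odd t) e 2ᵉ∣odd*geom))

pow-≡1-mod : ∀ M j → Σ ℕ λ z → (1 + M) ^ j ≡ 1 + M * z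
pow-≡1-mod M zero = 0 , cong suc (sym (*-zeroʳ M))
pow-≡1-mod M (suc j) with pow-≡1-mod M j
... | z , pow≡ = z + 1 + M * z , trans (cong ((1 + M) *_) pow≡) (expand M z)
  where
  expand : ∀ M z → (1 + M) * (1 + M * z) ≡ 1 + M * (z + 1 + M * z)
  expand = solve-∀

odd-pow : ∀ v j → Σ ℕ λ r → (1 + 2 * v) ^ j ≡ 1 + 2 * r
odd-pow v j with pow-≡1-mod (2 * v) j
... | z , pow≡ = v * z , trans pow≡ (cong suc (*-assoc 2 v z))

^-double : ∀ p j → p ^ (j + j) ≡ (p * p) ^ j
^-double p j = trans (^-distribˡ-+-* p j j) (sym (^-distribʳ-* p p j))

-- For an odd exponent, 1 + p^(2j+1) has the same 2-part as 1 + p when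
-- p = 1 + 2v is odd: it is 2(1+v) times an odd number.
one-plus-odd-power : ∀ v j → Σ ℕ λ s → 1 + (1 + 2 * v) ^ suc (j + j) ≡ 2 * suc v * (1 + 2 * s)
one-plus-odd-power v j with pow-≡1-mod (4 * suc v * v) j
... | z , pow≡ = v * z * p , (begin
  1 + p * p ^ (j + j)             ≡⟨ cong (λ w → 1 + p * w) (^-double p j) ⟩
  1 + p * (p * p) ^ j             ≡⟨ cong (λ w → 1 + p * w ^ j) (square v) ⟩
  1 + p * (1 + 4 * suc v * v) ^ j ≡⟨ cong (λ w → 1 + p * w) pow≡ ⟩
  1 + p * (1 + 4 * suc v * v * z) ≡⟨ factor v z ⟩
  2 * suc v * (1 + 2 * (v * z * p)) ∎)
  where
  p = 1 + 2 * v
  square : ∀ v → (1 + 2 * v) * (1 + 2 * v) ≡ 1 + 4 * suc v * v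
  square = solve-∀
  factor : ∀ v z → 1 + (1 + 2 * v) * (1 + 4 * suc v * v * z) ≡ 2 * suc v * (1 + 2 * (v * z * (1 + 2 * v)))
  factor = solve-∀

exp-bound : ∀ n → 3 ≤ n → 2 + (n + n) ≤ 2 ^ n
exp-bound 1 (s≤s ())
exp-bound 2 (s≤s (s≤s ()))
exp-bound 3 _ = ≤-refl
exp-bound (suc (suc (suc (suc n)))) _ =
  ≤-trans (step n) (*-monoʳ-≤ 2 (exp-bound (suc (suc (suc n))) (s≤s (s≤s (s≤s z≤n)))))
  where
  step : ∀ n → 2 + (4 + n + (4 + n)) ≤ 2 * (2 + (3 + n + (3 + n)))
  step n = subst (2 + (4 + n + (4 + n)) ≤_) (sum≡ n) (m≤m+n (2 + (4 + n + (4 + n))) (6 + (n + n)))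
    where
    sum≡ : ∀ n → 2 + (4 + n + (4 + n)) + (6 + (n + n)) ≡ 2 * (2 + (3 + n + (3 + n)))
    sum≡ = solve-∀

no-small-solution : ∀ k A → 3 ≤ k → 2 ^ k ≤ 2 + A → 2 ^ (A ∸ k) ≤ A → ⊥
no-small-solution k A 3≤k 2ᵏ≤2+A 2ᴬ⁻ᵏ≤A with k ≤? A
... | no k≰A = <-irrefl refl
  (≤-<-trans (≤-trans (exp-bound k 3≤k) 2ᵏ≤2+A) (+-monoʳ-< 2 (<-≤-trans (≰⇒> k≰A) (m≤m+n k k))))
... | yes k≤A with A ∸ k | m+[n∸m]≡n k≤A
...   | t | refl with k ≤? t
...     | yes k≤t = <-irrefl refl
  (≤-<-trans (≤-trans (exp-bound t (≤-trans 3≤k k≤t)) (≤-trans 2ᴬ⁻ᵏ≤A (+-monoˡ-≤ t k≤t))) (m<n+m (t + t) {2} z<s))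
...     | no k≰t = <-irrefl refl
  (≤-<-trans (≤-trans (exp-bound k 3≤k) 2ᵏ≤2+A) (+-monoʳ-< 2 (+-monoʳ-< k (≰⇒> k≰t))))

suc≤square : ∀ p → 1 < p → 1 + p ≤ p * p
suc≤square 1 (s≤s ())
suc≤square (suc (suc p)) _ = subst (3 + p ≤_) (expand p) (m≤m+n (3 + p) (1 + 3 * p + p * p))
  where
  expand : ∀ p → 3 + p + (1 + 3 * p + p * p) ≡ (2 + p) * (2 + p)
  expand = solve-∀

exponent-bound : ∀ p c m → 1 + p ≤ p * p → p ^ (c + c) < (1 + p) ^ m → c < m
exponent-bound p c m 1+p≤p² p²ᶜ<[1+p]ᵐ with m ≤? c
... | no m≰c = ≰⇒> m≰c
... | yes m≤c = contradiction p²ᶜ<[1+p]ᵐ (≤⇒≯ (≤-trans (^-monoʳ-≤ (1 + p) m≤c)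
      (subst ((1 + p) ^ c ≤_) (sym (^-double p c)) (^-monoˡ-≤ c 1+p≤p²))))

∣geom⇒≤length : ∀ p m → p ∣ geom (1 + p) (suc m) → p ≤ suc m
∣geom⇒≤length p m p∣geom with geom-mod p (suc m)
... | h , geom≡ = ∣⇒≤ (∣m+n∣m⇒∣n (subst (p ∣_) (trans geom≡ (+-comm (suc m) (p * h))) p∣geom) (m∣m*n h))

∣geom⇒< : ∀ p m d → d ∣ geom (1 + p) (suc m) → p * d < (1 + p) ^ suc m
∣geom⇒< p m d d∣geom = subst (p * d <_) (geom-telescope p (suc m))
  (≤-<-trans (*-monoʳ-≤ p (∣⇒≤ d∣geom)) (m<m+n (p * geom (1 + p) (suc m)) z<s))

geom-odd-power-2-part : ∀ v j A m → 2 ^ suc (j + j) ≡ 2 * suc v →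
  2 ^ suc A ∣ geom ((1 + 2 * v) ^ suc (j + j)) m →
  Σ ℕ λ c → m ≡ c + c × 2 ^ (suc A ∸ suc (j + j)) ∣ c
geom-odd-power-2-part v j A m 2ᵏ≡ 2ᴬ⁺¹∣T with odd-pow v (suc (j + j))
... | r , x≡ with geom-even⇒even-length r m
                    (∣-trans (m∣m*n (2 ^ A)) (subst (λ y → 2 ^ suc A ∣ geom y m) x≡ 2ᴬ⁺¹∣T))
... | c , refl with one-plus-odd-power v j
... | s , 1+x≡ = c , refl , 2ᴬ⁺¹⁻ᵏ∣c
  where
  k = suc (j + j)
  x = (1 + 2 * v) ^ k
  e = suc A ∸ k
  T≡ : geom x (c + c) ≡ 2 ^ k * ((1 + 2 * s) * geom (x * x) c)
  T≡ = begin
    geom x (c + c)                         ≡⟨ geom-double x c ⟩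
    (1 + x) * geom (x * x) c               ≡⟨ cong (_* geom (x * x) c) (trans 1+x≡ (cong (_* (1 + 2 * s)) (sym 2ᵏ≡))) ⟩
    2 ^ k * (1 + 2 * s) * geom (x * x) c   ≡⟨ *-assoc (2 ^ k) (1 + 2 * s) (geom (x * x) c) ⟩
    2 ^ k * ((1 + 2 * s) * geom (x * x) c) ∎
  x²≡ : x * x ≡ 1 + 4 * (r + r * r)
  x²≡ = trans (cong₂ _*_ x≡ x≡) (square r)
    where
    square : ∀ r → (1 + 2 * r) * (1 + 2 * r) ≡ 1 + 4 * (r + r * r)
    square = solve-∀
  2ᵉ∣geom : 2 ^ e ∣ geom (x * x) c
  2ᵉ∣geom = prime-power-cancel prime[2] (2∤odd s) e (^-∣-cancel 2 (suc A) k _ (subst (2 ^ suc A ∣_) T≡ 2ᴬ⁺¹∣T))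
  2ᴬ⁺¹⁻ᵏ∣c : 2 ^ e ∣ c
  2ᴬ⁺¹⁻ᵏ∣c = geom-2-adic e (r + r * r) c (subst (λ y → 2 ^ e ∣ geom y c) x²≡ 2ᵉ∣geom)

even-or-odd : ∀ n → Σ ℕ λ j → (n ≡ j + j) ⊎ (n ≡ suc (j + j))
even-or-odd zero = 0 , inj₁ refl
even-or-odd (suc n) with even-or-odd n
... | j , inj₁ refl = j , inj₂ refl
... | j , inj₂ refl = suc j , inj₁ (cong suc (sym (+-suc j j)))

prime>2⇒odd : ∀ {k} → Prime k → 2 < k → Σ ℕ λ j → k ≡ suc (j + j)
prime>2⇒odd {k} pk 2<k with even-or-odd k
... | j , inj₂ k≡ = j , k≡
... | j , inj₁ refl with prime⇒irreducible pk (divides j (double j))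
  where
  double : ∀ j → j + j ≡ j * 2
  double = solve-∀
...   | inj₁ ()
...   | inj₂ 2≡k = contradiction 2<k (<-irrefl 2≡k)

-- 2(1 + v) = 1 + (1 + 2v), relating the two ways the theorem writes 2ᵏ.
double-suc : ∀ v → 2 * suc v ≡ 1 + (1 + 2 * v)
double-suc = solve-∀

mersenne-odd : ∀ j p → 2 ^ suc j ≡ 1 + p → Σ ℕ λ v → p ≡ 1 + 2 * v
mersenne-odd j p 2ʲ⁺¹≡1+p = w , suc-injective (begin
  1 + p          ≡⟨ 2ʲ⁺¹≡1+p ⟨
  2 * 2 ^ j      ≡⟨ cong (2 *_) (suc-pred (2 ^ j) {{m^n≢0 2 j}}) ⟨
  2 * suc w      ≡⟨ double-suc w ⟩
  1 + (1 + 2 * w) ∎)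
  where
  w = pred (2 ^ j)

mersenne-case : ∀ j p a b → 3 ≤ suc (j + j) → Prime p → 2 ^ suc (j + j) ≡ 1 + p →
  ¬ (2 ^ suc a * p ^ suc b ∣ σ (suc (j + j)) (2 ^ suc a * p ^ suc b))
mersenne-case j p a b 3≤k pp 2ᵏ≡1+p n∣σ with mersenne-odd (j + j) p 2ᵏ≡1+p
... | v , refl = conclude (geom-odd-power-2-part v j a (suc B) 2ᵏ≡2[1+v] 2ᴬ∣T)
  where
  k = suc (j + j)
  A = suc a
  B = suc b
  S = geom (2 ^ k) (suc A)
  T = geom (p ^ k) (suc B)
  2ᵏ≡2[1+v] : 2 ^ k ≡ 2 * suc v
  2ᵏ≡2[1+v] = trans 2ᵏ≡1+p (sym (double-suc v))
  -- S is odd and T ≡ 1 (mod p), so the two prime powers separate.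
  2∤S : ¬ 2 ∣ S
  2∤S = subst (λ y → ¬ 2 ∣ geom y (suc A)) (sym 2ᵏ≡2[1+v]) (geom-prime∤ prime[2] (suc v) A)
  p∤T : ¬ p ∣ T
  p∤T = geom-prime∤ pp (p ^ (j + j)) B
  separated : 2 ^ A ∣ T × p ^ B ∣ S
  separated = separate-prime-powers prime[2] pp 2∤S p∤T A B
    (subst (2 ^ A * p ^ B ∣_) (σ-two-prime-powers prime[2] pp (2∤odd v) k A B) n∣σ)
  2ᴬ∣T : 2 ^ A ∣ T
  2ᴬ∣T = proj₁ separated
  pᴮ∣S : p ^ B ∣ geom (1 + p) (suc A)
  pᴮ∣S = subst (λ y → p ^ B ∣ geom y (suc A)) 2ᵏ≡1+p (proj₂ separated)
  2ᵏ≤2+A : 2 ^ k ≤ 2 + A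
  2ᵏ≤2+A = subst (_≤ 2 + A) (sym 2ᵏ≡1+p) (s≤s (∣geom⇒≤length p A (∣-trans (m∣m*n (p ^ b)) pᴮ∣S)))
  pᴮ⁺¹<[1+p]ᴬ⁺¹ : p ^ suc B < (1 + p) ^ suc A
  pᴮ⁺¹<[1+p]ᴬ⁺¹ = ∣geom⇒< p A (p ^ B) pᴮ∣S
  -- 2-part: B + 1 = 2c with 2^(A−k) ∣ c; then c ≤ A contradicts the size bounds.
  conclude : (Σ ℕ λ c → suc B ≡ c + c × 2 ^ (A ∸ k) ∣ c) → ⊥
  conclude (zero , () , _)
  conclude (suc c , B+1≡2c , 2ᴬ⁻ᵏ∣c) = no-small-solution k A 3≤k 2ᵏ≤2+A (≤-trans (∣⇒≤ 2ᴬ⁻ᵏ∣c) c≤A)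
    where
    c≤A : suc c ≤ A
    c≤A = ≤-pred (exponent-bound p (suc c) (suc A) (suc≤square p (nonTrivial⇒n>1 p {{prime⇒nonTrivial pp}}))
      (subst (λ e → p ^ e < (1 + p) ^ suc A) B+1≡2c pᴮ⁺¹<[1+p]ᴬ⁺¹))

lemma2p1 : (k α β : ℕ) → Prime k → 2 < k → Prime (2 ^ k ∸ 1) →
    1 < α → 1 < β →
    ¬ ((2 ^ (α ∸ 1) * (2 ^ k ∸ 1) ^ (β ∸ 1)) ∣ σ k (2 ^ (α ∸ 1) * (2 ^ k ∸ 1) ^ (β ∸ 1)))
lemma2p1 k 1 β _ _ _ (s≤s ()) _
lemma2p1 k α 1 _ _ _ _ (s≤s ())
lemma2p1 k (suc (suc a)) (suc (suc b)) k-prime 2<k p-prime _ _ with prime>2⇒odd k-prime 2<k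
... | j , refl = mersenne-case j (2 ^ k ∸ 1) a b 2<k p-prime (sym (m+[n∸m]≡n (m^n>0 2 k)))
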